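{- Let $n$ be an integer and let $k=\lceil \log_2(n)\rceil$, and suppose $0<n<2^k$ and $k<i$ for an integer $i$. Then $$f(2^i-n,i) = c(n) = f(2^k-n,k).$$
   Context: For an integer $n$ and an integer $i\ge 0$, $f(n,i)$ denotes the number of binary signed-digit (BSD) representations of $n$ on $i$ bits, i.e. the number of tuples $(b_{i-1},\dots,b_0)\in\{1,0,-1\}^i$ with $n=\sum_{j=0}^{i-1} b_j 2^j$. Stern's diatomic sequence $c$ is defined on non-negative integers by $c(0)=0$, $c(1)=1$, $c(2m)=c(m)$, and $c(2m+1)=c(m)+c(m+1)$. -}

module Defs where

open import Data.Nat as ℕ using (ℕ; zero; suc)
open import Data.Nat.DivMod using (_/_; _%_)
open import Data.Integer as ℤ using (ℤ; +_; -[1+_])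
open import Data.List using (List; []; _∷_; map; concatMap; filter; length)
open import Data.Vec using (Vec; []; _∷_)
open import Relation.Binary.PropositionalEquality using (_≡_)
open import Data.Integer.Properties using () renaming (_≟_ to _≟ℤ_)

data Digit : Set where
  d1 d0 dm1 : Digit

digitVal : Digit → ℤ
digitVal d1  = + 1
digitVal d0  = + 0
digitVal dm1 = -[1+ 0 ]

-- All tuples in {1,0,-1}^i (as vectors listed b_{i-1},...,b_0, i.e. head is the
-- most significant digit).
allTuples : (i : ℕ) → List (Vec Digit i)
allTuples zero    = [] ∷ []
allTuples (suc i) = concatMap (λ v → (d1 ∷ v) ∷ (d0 ∷ v) ∷ (dm1 ∷ v) ∷ []) (allTuples i)

value : {i : ℕ} → Vec Digit i → ℤ
value {zero}  []      = + 0
value {suc i} (b ∷ v) = digitVal b ℤ.* (+ (2 ℕ.^ i)) ℤ.+ value v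

f : ℤ → ℕ → ℕ
f n i = length (filter (λ v → value v ≟ℤ n) (allTuples i))

-- Stern's diatomic sequence, via fuel (fuel m+1 suffices for argument m).
sternF : ℕ → ℕ → ℕ
sternF zero    _ = 0
sternF (suc k) zero = 0
sternF (suc k) (suc zero) = 1
sternF (suc k) m@(suc (suc _)) with m % 2
... | zero  = sternF k (m / 2)
... | suc _ = sternF k (m / 2) ℕ.+ sternF k (suc (m / 2))

c : ℕ → ℕ
c m = sternF (suc m) m

-- Splitting off the leading digit gives f(m, i+1) = f(m - 2^i, i) + f(m, i) + f(m + 2^i, i),
-- and the terms with |m| >= 2^i vanish because every tuple on i bits has value of absolute
-- value below 2^i. For n + q = 2^(i+1) this leaves f(q, i+1) = f(q - 2^i, i) when n <= 2^i,
-- and f(p, i) + f(q, i) when n = 2^i + p (using f(-m, i) = f(m, i)). By induction on i the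
-- former is c(n) and the latter c(q) + c(p), which is c(2^i + p) = c(n) by Stern's identity
-- c(2^i + p) = c(p) + c(q) for p + q = 2^i.
module Submission where

open import Defs
open import Data.Nat using (ℕ; _<_; _^_)
open import Data.Nat.Properties using (≤-trans; <⇒≤; ^-monoʳ-≤)
open import Data.Nat.Logarithm using (⌈log₂_⌉)
open import Data.Integer as ℤ using (ℤ; +_)
open import Data.Product using (_×_; _,_)
open import Relation.Binary.PropositionalEquality using (_≡_; sym)

module Stern where

  open import Data.Nat
  open import Data.Nat.Properties
  open import Data.Nat.DivMod
  open import Data.Empty using (⊥-elim)
  open import Function using (_∘_)
  open import Data.Nat.Tactic.RingSolver using (solve-∀)
  open import Relation.Binary.PropositionalEquality
  open ≡-Reasoning

  data EvenOdd : ℕ → Set where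
    even : ∀ b → EvenOdd (b * 2)
    odd  : ∀ b → EvenOdd (1 + b * 2)

  evenOdd : ∀ m → EvenOdd m
  evenOdd zero = even 0
  evenOdd (suc m) with evenOdd m
  ... | even b = odd b
  ... | odd b  = even (suc b)

  [1+b*2]%2≡1 : ∀ b → (1 + b * 2) % 2 ≡ 1
  [1+b*2]%2≡1 b = [m+kn]%n≡m%n 1 b 2

  [1+b*2]/2≡b : ∀ b → (1 + b * 2) / 2 ≡ b
  [1+b*2]/2≡b b = begin
    (1 + b * 2) / 2     ≡⟨ cong (_/ 2) (+-comm 1 (b * 2)) ⟩
    (b * 2 + 1) / 2     ≡⟨ +-distrib-/ (b * 2) 1 (subst (λ r → r + 1 < 2) (sym (m*n%n≡0 b 2)) ≤-refl) ⟩
    b * 2 / 2 + 1 / 2   ≡⟨ +-identityʳ _ ⟩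
    b * 2 / 2           ≡⟨ m*n/n≡m b 2 ⟩
    b                   ∎

  sternF-unfold-even : ∀ k m → (2 + m) % 2 ≡ 0 → sternF (suc k) (2 + m) ≡ sternF k ((2 + m) / 2)
  sternF-unfold-even k m p with (2 + m) % 2 | p
  ... | zero | _ = refl

  sternF-unfold-odd : ∀ k m → (2 + m) % 2 ≡ 1 →
    sternF (suc k) (2 + m) ≡ sternF k ((2 + m) / 2) + sternF k (suc ((2 + m) / 2))
  sternF-unfold-odd k m p with (2 + m) % 2 | p
  ... | suc _ | _ = refl

  sternF-double : ∀ k b → sternF (suc k) (suc b * 2) ≡ sternF k (suc b)
  sternF-double k b =
    trans (sternF-unfold-even k (b * 2) (m*n%n≡0 (suc b) 2)) (cong (sternF k) (m*n/n≡m (suc b) 2))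

  sternF-double+1 : ∀ k b → sternF (suc k) (1 + suc b * 2) ≡ sternF k (suc b) + sternF k (2 + b)
  sternF-double+1 k b = trans (sternF-unfold-odd k (1 + b * 2) ([1+b*2]%2≡1 (suc b)))
    (cong₂ _+_ (cong (sternF k) half≡b) (cong (sternF k ∘ suc) half≡b))
    where half≡b : (1 + suc b * 2) / 2 ≡ suc b
          half≡b = [1+b*2]/2≡b (suc b)

  sternF-fuel-irrelevant : ∀ {k k′ m} → m < k → m < k′ → sternF k m ≡ sternF k′ m
  sternF-fuel-irrelevant {suc k} {suc k′} {m} (s≤s m≤k) (s≤s m≤k′) with evenOdd m
  ... | even zero    = refl
  ... | even (suc b) = begin
    sternF (suc k) (suc b * 2)  ≡⟨ sternF-double k b ⟩
    sternF k (suc b)            ≡⟨ sternF-fuel-irrelevant (<-≤-trans b+1<m m≤k) (<-≤-trans b+1<m m≤k′) ⟩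
    sternF k′ (suc b)           ≡⟨ sternF-double k′ b ⟨
    sternF (suc k′) (suc b * 2) ∎
    where b+1<m : suc b < suc b * 2
          b+1<m = s≤s (s≤s (m≤m*n b 2))
  ... | odd zero     = refl
  ... | odd (suc b)  = begin
    sternF (suc k) (1 + suc b * 2)        ≡⟨ sternF-double+1 k b ⟩
    sternF k (suc b) + sternF k (2 + b)
      ≡⟨ cong₂ _+_ (sternF-fuel-irrelevant (<-≤-trans b+1<m m≤k) (<-≤-trans b+1<m m≤k′))
                   (sternF-fuel-irrelevant (<-≤-trans b+2<m m≤k) (<-≤-trans b+2<m m≤k′)) ⟩
    sternF k′ (suc b) + sternF k′ (2 + b) ≡⟨ sternF-double+1 k′ b ⟨
    sternF (suc k′) (1 + suc b * 2)       ∎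
    where b+2<m : 2 + b < 1 + suc b * 2
          b+2<m = s≤s (s≤s (s≤s (m≤m*n b 2)))
          b+1<m : suc b < 1 + suc b * 2
          b+1<m = <-trans (n<1+n (suc b)) b+2<m

  c-double : ∀ b → c (b * 2) ≡ c b
  c-double zero    = refl
  c-double (suc b) = trans (sternF-double _ b) (sternF-fuel-irrelevant (s≤s (s≤s (m≤m*n b 2))) ≤-refl)

  c-double+1 : ∀ b → c (1 + b * 2) ≡ c b + c (suc b)
  c-double+1 zero    = refl
  c-double+1 (suc b) = trans (sternF-double+1 _ b)
    (cong₂ _+_ (sternF-fuel-irrelevant (s≤s (s≤s (m≤n⇒m≤1+n (m≤m*n b 2)))) ≤-refl)
               (sternF-fuel-irrelevant (s≤s (s≤s (s≤s (m≤m*n b 2)))) ≤-refl))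

  c[2^i+p]≡c[p]+c[q] : ∀ i p q → p + q ≡ 2 ^ i → c (2 ^ i + p) ≡ c p + c q
  c[2^i+p]≡c[p]+c[q] zero    zero       _ refl = refl
  c[2^i+p]≡c[p]+c[q] zero    (suc zero) _ refl = refl
  c[2^i+p]≡c[p]+c[q] (suc i) p q p+q≡2T with evenOdd p | evenOdd q
  ... | even a | even b = begin
    c (2 * T + a * 2)        ≡⟨ cong c (trans (cong (_+ a * 2) (*-comm 2 T)) (sym (*-distribʳ-+ 2 T a))) ⟩
    c ((T + a) * 2)          ≡⟨ c-double (T + a) ⟩
    c (T + a)                ≡⟨ c[2^i+p]≡c[p]+c[q] i a b a+b≡T ⟩
    c a + c b                ≡⟨ cong₂ _+_ (c-double a) (c-double b) ⟨
    c (a * 2) + c (b * 2)    ∎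
    where
    T : ℕ
    T = 2 ^ i
    a+b≡T : a + b ≡ T
    a+b≡T = *-cancelʳ-≡ (a + b) T 2 (trans (*-distribʳ-+ 2 a b) (trans p+q≡2T (*-comm 2 T)))
  ... | odd a  | odd b  = begin
    c (2 * T + (1 + a * 2))                ≡⟨ cong c (shift T a) ⟩
    c (1 + (T + a) * 2)                    ≡⟨ c-double+1 (T + a) ⟩
    c (T + a) + c (suc (T + a))
      ≡⟨ cong₂ _+_ (c[2^i+p]≡c[p]+c[q] i a (suc b) (trans (+-suc a b) 1+a+b≡T))
                   (trans (cong c (sym (+-suc T a))) (c[2^i+p]≡c[p]+c[q] i (suc a) b 1+a+b≡T)) ⟩
    (c a + c (suc b)) + (c (suc a) + c b)  ≡⟨ regroup (c a) (c (suc b)) (c (suc a)) (c b) ⟩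
    (c a + c (suc a)) + (c b + c (suc b))  ≡⟨ cong₂ _+_ (c-double+1 a) (c-double+1 b) ⟨
    c (1 + a * 2) + c (1 + b * 2)          ∎
    where
    T : ℕ
    T = 2 ^ i
    shift : ∀ t a → 2 * t + (1 + a * 2) ≡ 1 + (t + a) * 2
    shift = solve-∀
    regroup : ∀ w x y z → (w + x) + (y + z) ≡ (w + y) + (z + x)
    regroup = solve-∀
    pair : ∀ a b → (1 + a * 2) + (1 + b * 2) ≡ (suc a + b) * 2
    pair = solve-∀
    1+a+b≡T : suc a + b ≡ T
    1+a+b≡T = *-cancelʳ-≡ (suc a + b) T 2 (trans (sym (pair a b)) (trans p+q≡2T (*-comm 2 T)))
  ... | even a | odd b  = ⊥-elim (even≢odd (2 ^ i) (a + b) (trans (sym p+q≡2T) (sum a b)))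
    where sum : ∀ a b → a * 2 + (1 + b * 2) ≡ suc (2 * (a + b))
          sum = solve-∀
  ... | odd a  | even b = ⊥-elim (even≢odd (2 ^ i) (a + b) (trans (sym p+q≡2T) (sum a b)))
    where sum : ∀ a b → (1 + a * 2) + b * 2 ≡ suc (2 * (a + b))
          sum = solve-∀

module SignedDigits where

  open Stern using (c[2^i+p]≡c[p]+c[q])
  open import Data.Nat as ℕ using (ℕ; zero; suc; _^_)
  import Data.Nat.Properties as ℕ
  open import Data.Integer using (ℤ; +_; +0; -[1+_]; +[1+_]; _+_; _*_; -_; _-_; ∣_∣)
  open import Data.Integer.Properties
  open import Data.Integer.Tactic.RingSolver using (solve-∀)
  open import Data.List using (List; []; _∷_; [_]; _++_; concatMap; filter; length)
  open import Data.List.Properties using (filter-++; length-++; filter-none)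
  open import Data.List.Relation.Unary.All using (universal)
  open import Data.Product using (proj₁; proj₂)
  open import Data.Vec using (Vec; []; _∷_)
  open import Data.Empty using (⊥-elim)
  open import Relation.Binary.PropositionalEquality hiding ([_])
  open import Relation.Nullary using (yes; no)
  open import Function.Bundles using (_⇔_; mk⇔; Equivalence)

  count : ∀ {i} → ℤ → List (Vec Digit i) → ℕ
  count m vs = length (filter (λ v → value v ≟ m) vs)

  count-++ : ∀ {i} m (us vs : List (Vec Digit i)) → count m (us ++ vs) ≡ count m us ℕ.+ count m vs
  count-++ m us vs = trans (cong length (filter-++ (λ v → value v ≟ m) us vs)) (length-++ (filter _ us))

  a+x≡m⇔x≡m-a : ∀ a x m → (a + x ≡ m) ⇔ (x ≡ m - a)
  a+x≡m⇔x≡m-a a x m = mk⇔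
    (λ a+x≡m → trans (sym (a+x-a≡x a x)) (cong (_- a) a+x≡m))
    (λ x≡m-a → trans (cong (_+_ a) x≡m-a) (a+[m-a]≡m a m))
    where
    a+x-a≡x : ∀ a x → a + x - a ≡ x
    a+x-a≡x = solve-∀
    a+[m-a]≡m : ∀ a m → a + (m - a) ≡ m
    a+[m-a]≡m = solve-∀

  count-[]-cong : ∀ {i j} (u : Vec Digit i) (v : Vec Digit j) m m′ →
    (value u ≡ m ⇔ value v ≡ m′) → count m [ u ] ≡ count m′ [ v ]
  count-[]-cong u v m m′ u⇔v with value u ≟ m | value v ≟ m′
  ... | yes _   | yes _   = refl
  ... | no  _   | no  _   = refl
  ... | yes u≡m | no v≢m′ = ⊥-elim (v≢m′ (Equivalence.to u⇔v u≡m))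
  ... | no u≢m  | yes v≡m′ = ⊥-elim (u≢m (Equivalence.from u⇔v v≡m′))

  count-∷ : ∀ {i} d (v : Vec Digit i) m → count m [ d ∷ v ] ≡ count (m - digitVal d * + 2 ^ i) [ v ]
  count-∷ d v m = count-[]-cong (d ∷ v) v m _ (a+x≡m⇔x≡m-a _ (value v) m)

  extend : ∀ {i} → Vec Digit i → List (Vec Digit (suc i))
  extend v = (d1 ∷ v) ∷ (d0 ∷ v) ∷ (dm1 ∷ v) ∷ []

  count-extend-one : ∀ {i} m (v : Vec Digit i) →
    count m (extend v) ≡ count (m - + 2 ^ i) [ v ] ℕ.+ count m [ v ] ℕ.+ count (m + + 2 ^ i) [ v ]
  count-extend-one {i} m v = begin
    count m ([ d1 ∷ v ] ++ [ d0 ∷ v ] ++ [ dm1 ∷ v ])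
      ≡⟨ count-++ m [ d1 ∷ v ] _ ⟩
    count m [ d1 ∷ v ] ℕ.+ count m ([ d0 ∷ v ] ++ [ dm1 ∷ v ])
      ≡⟨ cong (count m [ d1 ∷ v ] ℕ.+_) (count-++ m [ d0 ∷ v ] _) ⟩
    count m [ d1 ∷ v ] ℕ.+ (count m [ d0 ∷ v ] ℕ.+ count m [ dm1 ∷ v ])
      ≡⟨ ℕ.+-assoc (count m [ d1 ∷ v ]) _ _ ⟨
    count m [ d1 ∷ v ] ℕ.+ count m [ d0 ∷ v ] ℕ.+ count m [ dm1 ∷ v ]
      ≡⟨ cong₂ ℕ._+_ (cong₂ ℕ._+_ (shifted d1 (m-1*t≡m-t m t)) (shifted d0 (m-0*t≡m m t)))
                     (shifted dm1 (m--1*t≡m+t m t)) ⟩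
    count (m - t) [ v ] ℕ.+ count m [ v ] ℕ.+ count (m + t) [ v ] ∎
    where
    open ≡-Reasoning
    t : ℤ
    t = + 2 ^ i
    shifted : ∀ d {m′} → m - digitVal d * t ≡ m′ → count m [ d ∷ v ] ≡ count m′ [ v ]
    shifted d eq = trans (count-∷ d v m) (cong (λ x → count x [ v ]) eq)
    m-1*t≡m-t : ∀ m t → m - + 1 * t ≡ m - t
    m-1*t≡m-t = solve-∀
    m-0*t≡m : ∀ m t → m - + 0 * t ≡ m
    m-0*t≡m = solve-∀
    m--1*t≡m+t : ∀ m t → m - -[1+ 0 ] * t ≡ m + t
    m--1*t≡m+t = solve-∀

  count-extend : ∀ {i} m (vs : List (Vec Digit i)) →
    count m (concatMap extend vs) ≡ count (m - + 2 ^ i) vs ℕ.+ count m vs ℕ.+ count (m + + 2 ^ i) vs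
  count-extend m [] = refl
  count-extend {i} m (v ∷ vs) = begin
    count m (extend v ++ concatMap extend vs)
      ≡⟨ count-++ m (extend v) _ ⟩
    count m (extend v) ℕ.+ count m (concatMap extend vs)
      ≡⟨ cong₂ ℕ._+_ (count-extend-one m v) (count-extend m vs) ⟩
    (count (m - t) [ v ] ℕ.+ count m [ v ] ℕ.+ count (m + t) [ v ])
      ℕ.+ (count (m - t) vs ℕ.+ count m vs ℕ.+ count (m + t) vs)
      ≡⟨ regroup (count (m - t) [ v ]) (count m [ v ]) (count (m + t) [ v ])
                 (count (m - t) vs) (count m vs) (count (m + t) vs) ⟩
    (count (m - t) [ v ] ℕ.+ count (m - t) vs) ℕ.+ (count m [ v ] ℕ.+ count m vs)
      ℕ.+ (count (m + t) [ v ] ℕ.+ count (m + t) vs)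
      ≡⟨ cong₂ ℕ._+_ (cong₂ ℕ._+_ (count-++ (m - t) [ v ] vs) (count-++ m [ v ] vs))
                     (count-++ (m + t) [ v ] vs) ⟨
    count (m - t) (v ∷ vs) ℕ.+ count m (v ∷ vs) ℕ.+ count (m + t) (v ∷ vs) ∎
    where
    open ≡-Reasoning
    t : ℤ
    t = + 2 ^ i
    regroup : ∀ a b c x y z → (a ℕ.+ b ℕ.+ c) ℕ.+ (x ℕ.+ y ℕ.+ z) ≡ (a ℕ.+ x) ℕ.+ (b ℕ.+ y) ℕ.+ (c ℕ.+ z)
    regroup = NS.solve-∀
      where import Data.Nat.Tactic.RingSolver as NS

  f-suc : ∀ m i → f m (suc i) ≡ f (m - + 2 ^ i) i ℕ.+ f m i ℕ.+ f (m + + 2 ^ i) i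
  f-suc m i = count-extend m (allTuples i)

  2^[1+i]≡2^i+2^i : ∀ i → 2 ^ suc i ≡ 2 ^ i ℕ.+ 2 ^ i
  2^[1+i]≡2^i+2^i i = cong (2 ^ i ℕ.+_) (ℕ.+-identityʳ (2 ^ i))

  ∣digitVal∣≤1 : ∀ d → ∣ digitVal d ∣ ℕ.≤ 1
  ∣digitVal∣≤1 d1  = ℕ.≤-refl
  ∣digitVal∣≤1 d0  = ℕ.z≤n
  ∣digitVal∣≤1 dm1 = ℕ.≤-refl

  ∣value∣<2^i : ∀ {i} (v : Vec Digit i) → ∣ value v ∣ ℕ.< 2 ^ i
  ∣value∣<2^i []            = ℕ.s≤s ℕ.z≤n
  ∣value∣<2^i {suc i} (d ∷ v) = begin-strict
    ∣ digitVal d * + 2 ^ i + value v ∣       ≤⟨ ∣i+j∣≤∣i∣+∣j∣ (digitVal d * + 2 ^ i) (value v) ⟩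
    ∣ digitVal d * + 2 ^ i ∣ ℕ.+ ∣ value v ∣  <⟨ ℕ.+-mono-≤-< ∣d*2^i∣≤2^i (∣value∣<2^i v) ⟩
    2 ^ i ℕ.+ 2 ^ i                          ≡⟨ 2^[1+i]≡2^i+2^i i ⟨
    2 ^ suc i                                ∎
    where
    open ℕ.≤-Reasoning
    ∣d*2^i∣≤2^i : ∣ digitVal d * + 2 ^ i ∣ ℕ.≤ 2 ^ i
    ∣d*2^i∣≤2^i = begin
      ∣ digitVal d * + 2 ^ i ∣    ≡⟨ ∣i*j∣≡∣i∣*∣j∣ (digitVal d) (+ 2 ^ i) ⟩
      ∣ digitVal d ∣ ℕ.* 2 ^ i    ≤⟨ ℕ.*-monoˡ-≤ (2 ^ i) (∣digitVal∣≤1 d) ⟩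
      1 ℕ.* 2 ^ i                ≡⟨ ℕ.*-identityˡ (2 ^ i) ⟩
      2 ^ i                      ∎

  2^i≤∣m∣⇒f≡0 : ∀ m i → 2 ^ i ℕ.≤ ∣ m ∣ → f m i ≡ 0
  2^i≤∣m∣⇒f≡0 m i 2^i≤∣m∣ =
    cong length (filter-none (λ v → value v ≟ m) (universal ¬value≡m (allTuples i)))
    where
    ¬value≡m : ∀ v → value v ≢ m
    ¬value≡m v refl = ℕ.≤⇒≯ 2^i≤∣m∣ (∣value∣<2^i v)

  f[-m]≡f[m] : ∀ m i → f (- m) i ≡ f m i
  f[-m]≡f[m] +0       zero = refl
  f[-m]≡f[m] +[1+ _ ] zero = refl
  f[-m]≡f[m] -[1+ _ ] zero = refl
  f[-m]≡f[m] m (suc i) = begin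
    f (- m) (suc i)                                ≡⟨ f-suc (- m) i ⟩
    f (- m - t) i ℕ.+ f (- m) i ℕ.+ f (- m + t) i
      ≡⟨ cong₂ ℕ._+_ (cong₂ ℕ._+_ (ih (m + t) (-m-t≡-[m+t] m t)) (ih m refl)) (ih (m - t) (-m+t≡-[m-t] m t)) ⟩
    f (m + t) i ℕ.+ f m i ℕ.+ f (m - t) i          ≡⟨ reverse (f (m + t) i) (f m i) (f (m - t) i) ⟩
    f (m - t) i ℕ.+ f m i ℕ.+ f (m + t) i          ≡⟨ f-suc m i ⟨
    f m (suc i)                                    ∎
    where
    open ≡-Reasoning
    t : ℤ
    t = + 2 ^ i
    ih : ∀ {x} y → x ≡ - y → f x i ≡ f y i
    ih y refl = f[-m]≡f[m] y i
    -m-t≡-[m+t] : ∀ m t → - m - t ≡ - (m + t)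
    -m-t≡-[m+t] = solve-∀
    -m+t≡-[m-t] : ∀ m t → - m + t ≡ - (m - t)
    -m+t≡-[m-t] = solve-∀
    reverse : ∀ a b c → a ℕ.+ b ℕ.+ c ≡ c ℕ.+ b ℕ.+ a
    reverse = NS.solve-∀
      where import Data.Nat.Tactic.RingSolver as NS

  f-suc-≥2^i : ∀ r i → f (+ (r ℕ.+ 2 ^ i)) (suc i) ≡ f (+ r) i
  f-suc-≥2^i r i = begin
    f (+ (r ℕ.+ T)) (suc i)                                    ≡⟨ f-suc (+ (r ℕ.+ T)) i ⟩
    f (+ (r ℕ.+ T) - + T) i ℕ.+ f (+ (r ℕ.+ T)) i ℕ.+ f (+ (r ℕ.+ T) + + T) i
      ≡⟨ cong₂ ℕ._+_ (cong₂ ℕ._+_ (cong (λ x → f x i) r+T-T≡r) (2^i≤∣m∣⇒f≡0 _ i (ℕ.m≤n+m T r)))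
                     (2^i≤∣m∣⇒f≡0 _ i (ℕ.m≤n+m T (r ℕ.+ T))) ⟩
    f (+ r) i ℕ.+ 0 ℕ.+ 0                                        ≡⟨ ℕ.+-identityʳ _ ⟩
    f (+ r) i ℕ.+ 0                                              ≡⟨ ℕ.+-identityʳ _ ⟩
    f (+ r) i                                                    ∎
    where
    open ≡-Reasoning
    T : ℕ
    T = 2 ^ i
    x+y-y≡x : ∀ x y → x + y - y ≡ x
    x+y-y≡x = solve-∀
    r+T-T≡r : + (r ℕ.+ T) - + T ≡ + r
    r+T-T≡r = trans (cong (_- + T) (pos-+ r T)) (x+y-y≡x (+ r) (+ T))

  f-suc-≤2^i : ∀ p q i → p ℕ.+ q ≡ 2 ^ i → f (+ q) (suc i) ≡ f (+ p) i ℕ.+ f (+ q) i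
  f-suc-≤2^i p q i p+q≡T = begin
    f (+ q) (suc i)                                     ≡⟨ f-suc (+ q) i ⟩
    f (+ q - + T) i ℕ.+ f (+ q) i ℕ.+ f (+ q + + T) i
      ≡⟨ cong₂ ℕ._+_ (cong (λ x → f x i ℕ.+ f (+ q) i) q-T≡-p) (2^i≤∣m∣⇒f≡0 _ i (ℕ.m≤n+m T q)) ⟩
    f (- + p) i ℕ.+ f (+ q) i ℕ.+ 0                    ≡⟨ ℕ.+-identityʳ _ ⟩
    f (- + p) i ℕ.+ f (+ q) i                          ≡⟨ cong (ℕ._+ f (+ q) i) (f[-m]≡f[m] (+ p) i) ⟩
    f (+ p) i ℕ.+ f (+ q) i                            ∎
    where
    open ≡-Reasoning
    T : ℕ
    T = 2 ^ i
    y-[x+y]≡-x : ∀ x y → y - (x + y) ≡ - x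
    y-[x+y]≡-x = solve-∀
    q-T≡-p : + q - + T ≡ - + p
    q-T≡-p = begin
      + q - + T              ≡⟨ cong (λ x → + q - + x) (sym p+q≡T) ⟩
      + q - + (p ℕ.+ q)      ≡⟨ cong (λ x → + q - x) (pos-+ p q) ⟩
      + q - (+ p + + q)      ≡⟨ y-[x+y]≡-x (+ p) (+ q) ⟩
      - + p                  ∎

  f[q]≡c[n] : ∀ i n q → n ℕ.+ q ≡ 2 ^ i → f (+ q) i ≡ c n
  f[q]≡c[n] zero    zero             _ refl = refl
  f[q]≡c[n] zero    (suc zero)       _ refl = refl
  f[q]≡c[n] (suc i) n q n+q≡2T with n ℕ.≤? 2 ^ i
  ... | yes n≤T = begin
    f (+ q) (suc i)           ≡⟨ cong (λ x → f (+ x) (suc i)) q≡r+T ⟩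
    f (+ (r ℕ.+ T)) (suc i)   ≡⟨ f-suc-≥2^i r i ⟩
    f (+ r) i                 ≡⟨ f[q]≡c[n] i n r n+r≡T ⟩
    c n                       ∎
    where
    open ≡-Reasoning
    T : ℕ
    T = 2 ^ i
    r : ℕ
    r = proj₁ (ℕ.m≤n⇒∃[o]m+o≡n n≤T)
    n+r≡T : n ℕ.+ r ≡ T
    n+r≡T = proj₂ (ℕ.m≤n⇒∃[o]m+o≡n n≤T)
    q≡r+T : q ≡ r ℕ.+ T
    q≡r+T = ℕ.+-cancelˡ-≡ n q (r ℕ.+ T) (begin
      n ℕ.+ q            ≡⟨ trans n+q≡2T (2^[1+i]≡2^i+2^i i) ⟩
      T ℕ.+ T            ≡⟨ cong (ℕ._+ T) n+r≡T ⟨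
      n ℕ.+ r ℕ.+ T      ≡⟨ ℕ.+-assoc n r T ⟩
      n ℕ.+ (r ℕ.+ T)    ∎)
  ... | no n≰T = begin
    f (+ q) (suc i)           ≡⟨ f-suc-≤2^i p q i p+q≡T ⟩
    f (+ p) i ℕ.+ f (+ q) i
      ≡⟨ cong₂ ℕ._+_ (f[q]≡c[n] i q p (trans (ℕ.+-comm q p) p+q≡T)) (f[q]≡c[n] i p q p+q≡T) ⟩
    c q ℕ.+ c p               ≡⟨ ℕ.+-comm (c q) (c p) ⟩
    c p ℕ.+ c q               ≡⟨ c[2^i+p]≡c[p]+c[q] i p q p+q≡T ⟨
    c (T ℕ.+ p)               ≡⟨ cong c T+p≡n ⟩
    c n                       ∎
    where
    open ≡-Reasoning
    T : ℕ
    T = 2 ^ i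
    T≤n : T ℕ.≤ n
    T≤n = ℕ.<⇒≤ (ℕ.≰⇒> n≰T)
    p : ℕ
    p = proj₁ (ℕ.m≤n⇒∃[o]m+o≡n T≤n)
    T+p≡n : T ℕ.+ p ≡ n
    T+p≡n = proj₂ (ℕ.m≤n⇒∃[o]m+o≡n T≤n)
    p+q≡T : p ℕ.+ q ≡ T
    p+q≡T = ℕ.+-cancelˡ-≡ T (p ℕ.+ q) T (begin
      T ℕ.+ (p ℕ.+ q)    ≡⟨ ℕ.+-assoc T p q ⟨
      T ℕ.+ p ℕ.+ q      ≡⟨ cong (ℕ._+ q) T+p≡n ⟩
      n ℕ.+ q            ≡⟨ trans n+q≡2T (2^[1+i]≡2^i+2^i i) ⟩
      T ℕ.+ T            ∎)

  f[2^i-n]≡c[n] : ∀ n i → n ℕ.≤ 2 ^ i → f (+ 2 ^ i - + n) i ≡ c n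
  f[2^i-n]≡c[n] n i n≤2^i = begin
    f (+ 2 ^ i - + n) i     ≡⟨ cong (λ x → f x i) (trans (m-n≡m⊖n (2 ^ i) n) (⊖-≥ n≤2^i)) ⟩
    f (+ (2 ^ i ℕ.∸ n)) i   ≡⟨ f[q]≡c[n] i n (2 ^ i ℕ.∸ n) (ℕ.m+[n∸m]≡n n≤2^i) ⟩
    c n                     ∎
    where open ≡-Reasoning

corollary2 : (n i : ℕ) → 0 < n → n < 2 ^ ⌈log₂ n ⌉ → ⌈log₂ n ⌉ < i →
    (f (+ (2 ^ i) ℤ.- + n) i ≡ c n) × (c n ≡ f (+ (2 ^ ⌈log₂ n ⌉) ℤ.- + n) ⌈log₂ n ⌉)
corollary2 n i _ n<2^k k<i =
  f[2^i-n]≡c[n] n i (≤-trans (<⇒≤ n<2^k) (^-monoʳ-≤ 2 (<⇒≤ k<i))) ,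
  sym (f[2^i-n]≡c[n] n ⌈log₂ n ⌉ (<⇒≤ n<2^k))
  where open SignedDigits using (f[2^i-n]≡c[n])
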